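{- A normalisation structure on a cd-category $\mathcal{C}$ is unique whenever it exists: if $\mathrm{norm}$ and $\mathrm{norm}'$ are both normalisations on $\mathcal{C}$, then $\mathrm{norm}(f)=\mathrm{norm}'(f)$ for every morphism $f$.
   Context: A cd-category is a symmetric monoidal category $(\mathcal{C},\otimes,I)$ in which every object $X$ carries $\Delta_X\colon X\to X\otimes X$ and $\epsilon_X\colon X\to I$ forming a commutative comonoid, compatible with the tensor. For $f,g\colon X\to Y$, $g$ normalises $f$ if $f=(g\otimes(\epsilon_Y\circ f))\circ\Delta_X$; $g$ is a partial channel if it normalises itself. Normalisation on $\mathcal{C}$: an assignment to each $f\colon X\to Y$ of a partial channel $\mathrm{norm}(f)\colon X\to Y$ that normalises $f$, such that (N1) $\mathrm{norm}(f)=f$ when $f$ is a partial channel; (N2) $\mathrm{norm}(f\otimes g)=\mathrm{norm}(f)\otimes\mathrm{norm}(g)$; (N3) $\mathrm{norm}(\epsilon_Y\circ f)=\epsilon_Y\circ\mathrm{norm}(f)$; (N4) $\mathrm{norm}(f\circ\Delta_X)=\mathrm{norm}(f)\circ\Delta_X$ for all $f\colon X\otimes X\to Y$. -}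

module Defs where

open import Level using (Level; suc; _⊔_)
open import Relation.Binary.Structures using (IsEquivalence)

record CDCategory (o ℓ e : Level) : Set (suc (o ⊔ ℓ ⊔ e)) where
  infixr 9 _∘_
  infixr 10 _⊗₀_ _⊗₁_
  infix  4 _≈_
  field
    Obj  : Set o
    Hom  : Obj → Obj → Set ℓ
    _≈_  : ∀ {A B} → Hom A B → Hom A B → Set e
    id   : ∀ {A} → Hom A A
    _∘_  : ∀ {A B C} → Hom B C → Hom A B → Hom A C
    ≈-equiv : ∀ {A B} → IsEquivalence (_≈_ {A} {B})
    ∘-cong  : ∀ {A B C} {f h : Hom B C} {g k : Hom A B} → f ≈ h → g ≈ k → f ∘ g ≈ h ∘ k
    assoc   : ∀ {A B C D} {f : Hom A B} {g : Hom B C} {h : Hom C D} → (h ∘ g) ∘ f ≈ h ∘ (g ∘ f)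
    identityˡ : ∀ {A B} {f : Hom A B} → id ∘ f ≈ f
    identityʳ : ∀ {A B} {f : Hom A B} → f ∘ id ≈ f
    _⊗₀_ : Obj → Obj → Obj
    _⊗₁_ : ∀ {A B C D} → Hom A B → Hom C D → Hom (A ⊗₀ C) (B ⊗₀ D)
    I    : Obj
    ⊗-cong : ∀ {A B C D} {f h : Hom A B} {g k : Hom C D} → f ≈ h → g ≈ k → f ⊗₁ g ≈ h ⊗₁ k
    ⊗-id   : ∀ {A C} → id {A} ⊗₁ id {C} ≈ id
    ⊗-∘    : ∀ {A B C D E F} {f : Hom B C} {g : Hom A B} {h : Hom E F} {k : Hom D E}
             → (f ∘ g) ⊗₁ (h ∘ k) ≈ (f ⊗₁ h) ∘ (g ⊗₁ k)
    α   : ∀ {X Y Z} → Hom ((X ⊗₀ Y) ⊗₀ Z) (X ⊗₀ (Y ⊗₀ Z))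
    α⁻¹ : ∀ {X Y Z} → Hom (X ⊗₀ (Y ⊗₀ Z)) ((X ⊗₀ Y) ⊗₀ Z)
    λ⇒  : ∀ {X} → Hom (I ⊗₀ X) X
    λ⇐  : ∀ {X} → Hom X (I ⊗₀ X)
    ρ⇒  : ∀ {X} → Hom (X ⊗₀ I) X
    ρ⇐  : ∀ {X} → Hom X (X ⊗₀ I)
    α-isoˡ : ∀ {X Y Z} → α⁻¹ ∘ α {X} {Y} {Z} ≈ id
    α-isoʳ : ∀ {X Y Z} → α {X} {Y} {Z} ∘ α⁻¹ ≈ id
    λ-isoˡ : ∀ {X} → λ⇐ ∘ λ⇒ {X} ≈ id
    λ-isoʳ : ∀ {X} → λ⇒ {X} ∘ λ⇐ ≈ id
    ρ-isoˡ : ∀ {X} → ρ⇐ ∘ ρ⇒ {X} ≈ id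
    ρ-isoʳ : ∀ {X} → ρ⇒ {X} ∘ ρ⇐ ≈ id
    α-natural : ∀ {A B C D E F} {f : Hom A B} {g : Hom C D} {h : Hom E F}
                → α ∘ ((f ⊗₁ g) ⊗₁ h) ≈ (f ⊗₁ (g ⊗₁ h)) ∘ α
    λ-natural : ∀ {A B} {f : Hom A B} → λ⇒ ∘ (id ⊗₁ f) ≈ f ∘ λ⇒
    ρ-natural : ∀ {A B} {f : Hom A B} → ρ⇒ ∘ (f ⊗₁ id) ≈ f ∘ ρ⇒
    pentagon : ∀ {W X Y Z}
               → (id {W} ⊗₁ α {X} {Y} {Z}) ∘ α ∘ (α ⊗₁ id) ≈ α ∘ α
    triangle : ∀ {X Y} → (id {X} ⊗₁ λ⇒ {Y}) ∘ α ≈ ρ⇒ ⊗₁ id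
    σ : ∀ {X Y} → Hom (X ⊗₀ Y) (Y ⊗₀ X)
    σ-natural : ∀ {A B C D} {f : Hom A B} {g : Hom C D} → σ ∘ (f ⊗₁ g) ≈ (g ⊗₁ f) ∘ σ
    σ-involutive : ∀ {X Y} → σ {Y} {X} ∘ σ {X} {Y} ≈ id
    hexagon : ∀ {X Y Z}
              → α {Y} {Z} {X} ∘ σ ∘ α ≈ (id ⊗₁ σ) ∘ α ∘ (σ ⊗₁ id)
    Δ : ∀ {X} → Hom X (X ⊗₀ X)
    ε : ∀ {X} → Hom X I
    counitˡ : ∀ {X} → λ⇒ ∘ (ε ⊗₁ id) ∘ Δ {X} ≈ id
    counitʳ : ∀ {X} → ρ⇒ ∘ (id ⊗₁ ε) ∘ Δ {X} ≈ id
    coassoc : ∀ {X} → α ∘ (Δ ⊗₁ id) ∘ Δ {X} ≈ (id ⊗₁ Δ) ∘ Δ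
    cocomm  : ∀ {X} → σ ∘ Δ {X} ≈ Δ
    ε-I : ε {I} ≈ id
    ε-⊗ : ∀ {X Y} → ε {X ⊗₀ Y} ≈ λ⇒ ∘ (ε {X} ⊗₁ ε {Y})
    Δ-I : Δ {I} ≈ λ⇐
    Δ-⊗ : ∀ {X Y} → Δ {X ⊗₀ Y}
          ≈ (α⁻¹ ∘ (id ⊗₁ (α ∘ (σ ⊗₁ id) ∘ α⁻¹)) ∘ α) ∘ (Δ {X} ⊗₁ Δ {Y})

  Normalises : ∀ {X Y} → Hom X Y → Hom X Y → Set e
  Normalises {X} {Y} g f = f ≈ ρ⇒ ∘ (g ⊗₁ (ε {Y} ∘ f)) ∘ Δ {X}

  PartialChannel : ∀ {X Y} → Hom X Y → Set e
  PartialChannel g = Normalises g g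

record Normalisation {o ℓ e} (C : CDCategory o ℓ e) : Set (o ⊔ ℓ ⊔ e) where
  open CDCategory C
  field
    norm : ∀ {X Y} → Hom X Y → Hom X Y
    norm-cong : ∀ {X Y} {f g : Hom X Y} → f ≈ g → norm f ≈ norm g
    norm-partial    : ∀ {X Y} (f : Hom X Y) → PartialChannel (norm f)
    norm-normalises : ∀ {X Y} (f : Hom X Y) → Normalises (norm f) f
    N1 : ∀ {X Y} (f : Hom X Y) → PartialChannel f → norm f ≈ f
    N2 : ∀ {A B C D} (f : Hom A B) (g : Hom C D) → norm (f ⊗₁ g) ≈ norm f ⊗₁ norm g
    N3 : ∀ {X Y} (f : Hom X Y) → norm (ε {Y} ∘ f) ≈ ε {Y} ∘ norm f
    N4 : ∀ {X Y} (f : Hom (X ⊗₀ X) Y) → norm (f ∘ Δ {X}) ≈ norm f ∘ Δ {X}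

{-# OPTIONS --safe #-}
module Submission where

-- Let h be a partial channel normalising f. Applying norm to
-- ρ⇐ ∘ f = (h ⊗ ε f) ∘ Δ and pushing it through Δ, ⊗ and ε with (N2)–(N4),
-- while (N1) fixes h, shows that h also normalises norm f. For a scalar
-- s : X → I this gives norm s = (norm′ s ⊗ norm s) ∘ Δ and, symmetrically,
-- norm′ s = (norm s ⊗ norm′ s) ∘ Δ; the two agree because Δ is cocommutative
-- and σ is the identity on I ⊗ I. Finally norm′ f is a partial channel
-- normalising norm f with the same discard ε ∘ norm f = norm (ε ∘ f), so the
-- two coincide.

open import Defs
open import Level using (Level)
open import Relation.Binary.Bundles using (Setoid)
open import Relation.Binary.Structures using (IsEquivalence)
import Relation.Binary.Reasoning.Setoid as SetoidReasoning

module CDCategoryProperties {o ℓ e : Level} (C : CDCategory o ℓ e) where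
  open CDCategory C

  hom-setoid : Obj → Obj → Setoid ℓ e
  hom-setoid A B = record { Carrier = Hom A B ; _≈_ = _≈_ ; isEquivalence = ≈-equiv }

  private
    module ≈ {A B : Obj} = IsEquivalence (≈-equiv {A} {B})
    module HomReasoning {A B : Obj} = SetoidReasoning (hom-setoid A B)
    open HomReasoning

  pullˡ : ∀ {A B C D} {f : Hom C D} {g : Hom B C} {h : Hom A B} {k : Hom B D}
        → f ∘ g ≈ k → f ∘ g ∘ h ≈ k ∘ h
  pullˡ p = ≈.trans (≈.sym assoc) (∘-cong p ≈.refl)

  cancelˡ : ∀ {A B C} {f : Hom B C} {g : Hom C B} {h : Hom A C}
          → f ∘ g ≈ id → f ∘ g ∘ h ≈ h
  cancelˡ p = ≈.trans (pullˡ p) identityˡ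

  ρ⇐-natural : ∀ {A B} {f : Hom A B} → ρ⇐ ∘ f ≈ (f ⊗₁ id) ∘ ρ⇐
  ρ⇐-natural {f = f} = begin
    ρ⇐ ∘ f                       ≈⟨ ∘-cong ≈.refl (≈.sym (≈.trans (∘-cong ≈.refl ρ-isoʳ) identityʳ)) ⟩
    ρ⇐ ∘ f ∘ ρ⇒ ∘ ρ⇐             ≈⟨ ∘-cong ≈.refl (pullˡ (≈.sym ρ-natural)) ⟩
    ρ⇐ ∘ (ρ⇒ ∘ (f ⊗₁ id)) ∘ ρ⇐   ≈⟨ ∘-cong ≈.refl assoc ⟩
    ρ⇐ ∘ ρ⇒ ∘ (f ⊗₁ id) ∘ ρ⇐     ≈⟨ cancelˡ ρ-isoˡ ⟩
    (f ⊗₁ id) ∘ ρ⇐               ∎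

  ρ⇐≈discardʳ∘Δ : ∀ {X} → ρ⇐ {X} ≈ (id ⊗₁ ε) ∘ Δ
  ρ⇐≈discardʳ∘Δ = begin
    ρ⇐                         ≈⟨ ≈.sym identityʳ ⟩
    ρ⇐ ∘ id                    ≈⟨ ∘-cong ≈.refl (≈.sym counitʳ) ⟩
    ρ⇐ ∘ ρ⇒ ∘ (id ⊗₁ ε) ∘ Δ    ≈⟨ cancelˡ ρ-isoˡ ⟩
    (id ⊗₁ ε) ∘ Δ              ∎

  ⊗ε∘Δ≈ρ⇐∘ : ∀ {A B} {f : Hom A B} → (f ⊗₁ ε) ∘ Δ ≈ ρ⇐ ∘ f
  ⊗ε∘Δ≈ρ⇐∘ {f = f} = begin
    (f ⊗₁ ε) ∘ Δ                  ≈⟨ ∘-cong (⊗-cong (≈.sym identityʳ) (≈.sym identityˡ)) ≈.refl ⟩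
    ((f ∘ id) ⊗₁ (id ∘ ε)) ∘ Δ    ≈⟨ ≈.trans (∘-cong ⊗-∘ ≈.refl) assoc ⟩
    (f ⊗₁ id) ∘ (id ⊗₁ ε) ∘ Δ     ≈⟨ ∘-cong ≈.refl (≈.sym ρ⇐≈discardʳ∘Δ) ⟩
    (f ⊗₁ id) ∘ ρ⇐                ≈⟨ ≈.sym ρ⇐-natural ⟩
    ρ⇐ ∘ f                        ∎

  ε-I-∘ : ∀ {A} {s : Hom A I} → ε ∘ s ≈ s
  ε-I-∘ = ≈.trans (∘-cong ε-I ≈.refl) identityˡ

  σ-I-I : σ {I} {I} ≈ id
  σ-I-I = begin
    σ                 ≈⟨ ≈.sym identityʳ ⟩
    σ ∘ id            ≈⟨ ∘-cong ≈.refl (≈.sym λ-isoˡ) ⟩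
    σ ∘ λ⇐ ∘ λ⇒       ≈⟨ pullˡ (≈.trans (∘-cong ≈.refl (≈.sym Δ-I)) (≈.trans cocomm Δ-I)) ⟩
    λ⇐ ∘ λ⇒           ≈⟨ λ-isoˡ ⟩
    id                ∎

  scalar-⊗∘Δ-comm : ∀ {X} {s t : Hom X I} → (s ⊗₁ t) ∘ Δ ≈ (t ⊗₁ s) ∘ Δ
  scalar-⊗∘Δ-comm {s = s} {t} = begin
    (s ⊗₁ t) ∘ Δ          ≈⟨ ≈.sym identityˡ ⟩
    id ∘ (s ⊗₁ t) ∘ Δ     ≈⟨ ∘-cong (≈.sym σ-I-I) ≈.refl ⟩
    σ ∘ (s ⊗₁ t) ∘ Δ      ≈⟨ ≈.trans (pullˡ σ-natural) assoc ⟩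
    (t ⊗₁ s) ∘ σ ∘ Δ      ≈⟨ ∘-cong ≈.refl cocomm ⟩
    (t ⊗₁ s) ∘ Δ          ∎

  normalises⇒ρ⇐ : ∀ {X Y} {g f : Hom X Y} → Normalises g f → ρ⇐ ∘ f ≈ (g ⊗₁ (ε ∘ f)) ∘ Δ
  normalises⇒ρ⇐ p = ≈.trans (∘-cong ≈.refl p) (cancelˡ ρ-isoˡ)

  ρ⇐⇒normalises : ∀ {X Y} {g f : Hom X Y} → ρ⇐ ∘ f ≈ (g ⊗₁ (ε ∘ f)) ∘ Δ → Normalises g f
  ρ⇐⇒normalises p = ≈.trans (≈.sym (cancelˡ ρ-isoʳ)) (∘-cong ≈.refl p)

  ε-partialChannel : ∀ {X} → PartialChannel (ε {X})
  ε-partialChannel = ρ⇐⇒normalises (begin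
    ρ⇐ ∘ ε               ≈⟨ ≈.sym ⊗ε∘Δ≈ρ⇐∘ ⟩
    (ε ⊗₁ ε) ∘ Δ         ≈⟨ ∘-cong (⊗-cong ≈.refl (≈.sym ε-I-∘)) ≈.refl ⟩
    (ε ⊗₁ (ε ∘ ε)) ∘ Δ   ∎)

  scalar-normalises : ∀ {X} {g s : Hom X I} → Normalises g s → s ≈ ρ⇒ ∘ (g ⊗₁ s) ∘ Δ
  scalar-normalises p = ≈.trans p (∘-cong ≈.refl (∘-cong (⊗-cong ≈.refl ε-I-∘) ≈.refl))

  partialChannel-unique : ∀ {X Y} {g f : Hom X Y} → PartialChannel g → Normalises g f
                        → ε ∘ f ≈ ε ∘ g → f ≈ g
  partialChannel-unique {g = g} {f} pg gf εf≈εg = begin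
    f                             ≈⟨ gf ⟩
    ρ⇒ ∘ (g ⊗₁ (ε ∘ f)) ∘ Δ       ≈⟨ ∘-cong ≈.refl (∘-cong (⊗-cong ≈.refl εf≈εg) ≈.refl) ⟩
    ρ⇒ ∘ (g ⊗₁ (ε ∘ g)) ∘ Δ       ≈⟨ ≈.sym pg ⟩
    g                             ∎

  module NormalisationProperties (N : Normalisation C) where
    open Normalisation N

    normalises-norm : ∀ {X Y} {h f : Hom X Y} → PartialChannel h → Normalises h f
                    → Normalises h (norm f)
    normalises-norm {h = h} {f} ph hf = ρ⇐⇒normalises (begin
      ρ⇐ ∘ norm f                     ≈⟨ ≈.sym ⊗ε∘Δ≈ρ⇐∘ ⟩
      (norm f ⊗₁ ε) ∘ Δ               ≈⟨ ∘-cong (⊗-cong ≈.refl (≈.sym (N1 ε ε-partialChannel))) ≈.refl ⟩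
      (norm f ⊗₁ norm ε) ∘ Δ          ≈⟨ ∘-cong (≈.sym (N2 f ε)) ≈.refl ⟩
      norm (f ⊗₁ ε) ∘ Δ               ≈⟨ ≈.sym (N4 _) ⟩
      norm ((f ⊗₁ ε) ∘ Δ)             ≈⟨ norm-cong (≈.trans ⊗ε∘Δ≈ρ⇐∘ (normalises⇒ρ⇐ hf)) ⟩
      norm ((h ⊗₁ (ε ∘ f)) ∘ Δ)       ≈⟨ N4 _ ⟩
      norm (h ⊗₁ (ε ∘ f)) ∘ Δ         ≈⟨ ∘-cong (N2 h _) ≈.refl ⟩
      (norm h ⊗₁ norm (ε ∘ f)) ∘ Δ    ≈⟨ ∘-cong (⊗-cong (N1 h ph) (N3 f)) ≈.refl ⟩
      (h ⊗₁ (ε ∘ norm f)) ∘ Δ         ∎)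

  module _ (n n′ : Normalisation C) where
    open Normalisation n
    open Normalisation n′ using () renaming (norm to norm′; norm-partial to norm′-partial;
      norm-normalises to norm′-normalises; N3 to N3′)
    open NormalisationProperties n using (normalises-norm)
    open NormalisationProperties n′ using () renaming (normalises-norm to normalises-norm′)

    norm′-normalises-norm : ∀ {X Y} (f : Hom X Y) → Normalises (norm′ f) (norm f)
    norm′-normalises-norm f = normalises-norm (norm′-partial f) (norm′-normalises f)

    norm-normalises-norm′ : ∀ {X Y} (f : Hom X Y) → Normalises (norm f) (norm′ f)
    norm-normalises-norm′ f = normalises-norm′ (norm-partial f) (norm-normalises f)

    norm-unique-scalar : ∀ {X} (s : Hom X I) → norm s ≈ norm′ s
    norm-unique-scalar s = begin
      norm s                            ≈⟨ scalar-normalises (norm′-normalises-norm s) ⟩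
      ρ⇒ ∘ (norm′ s ⊗₁ norm s) ∘ Δ      ≈⟨ ∘-cong ≈.refl scalar-⊗∘Δ-comm ⟩
      ρ⇒ ∘ (norm s ⊗₁ norm′ s) ∘ Δ      ≈⟨ ≈.sym (scalar-normalises (norm-normalises-norm′ s)) ⟩
      norm′ s                           ∎

    norm-unique : ∀ {X Y} (f : Hom X Y) → norm f ≈ norm′ f
    norm-unique f = partialChannel-unique (norm′-partial f) (norm′-normalises-norm f) (begin
      ε ∘ norm f       ≈⟨ ≈.sym (N3 f) ⟩
      norm (ε ∘ f)     ≈⟨ norm-unique-scalar (ε ∘ f) ⟩
      norm′ (ε ∘ f)    ≈⟨ N3′ f ⟩
      ε ∘ norm′ f      ∎)

corollaryB5 : ∀ {o ℓ e : Level} (C : CDCategory o ℓ e) (n n′ : Normalisation C)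
    → ∀ {X Y} (f : CDCategory.Hom C X Y)
    → CDCategory._≈_ C (Normalisation.norm n f) (Normalisation.norm n′ f)
corollaryB5 C = CDCategoryProperties.norm-unique C
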